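{- Let $g\geq 3$ and let $G=(V,E)$ be a graph with no cycles of length at most $g$. For any subset $A\subseteq V$ with $|A|=g+1$, the induced subgraph $G[A]$ is a cycle of length $g+1$ if and only if $G[A\setminus\{a\}]$ is connected for every $a\in A$.
   Context: Graphs are finite and simple. -}

module Defs where

open import Data.Nat using (ℕ; zero; suc; _≤_)
open import Data.Fin using (Fin; toℕ)
open import Data.Fin.Subset using (Subset; _∈_; _-_; ∣_∣)
open import Data.Product using (Σ; ∃; _×_; _,_)
open import Data.Sum using (_⊎_)
open import Relation.Nullary using (¬_)
open import Relation.Binary using (Decidable)
open import Relation.Binary.PropositionalEquality using (_≡_)
open import Function.Definitions using (Injective)
open import Function.Bundles using (_⇔_)

record Graph : Set₁ where
  field
    n      : ℕ
    Adj    : Fin n → Fin n → Set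
    adj?   : Decidable Adj
    sym    : ∀ {u v} → Adj u v → Adj v u
    irrefl : ∀ {u} → ¬ Adj u u

open Graph public

Consecutive : (k : ℕ) → Fin k → Fin k → Set
Consecutive k i j = (toℕ j ≡ suc (toℕ i)) ⊎ ((suc (toℕ i) ≡ k) × (toℕ j ≡ 0))

HasCycleOfLength : (G : Graph) → ℕ → Set
HasCycleOfLength G k =
  (3 ≤ k) × Σ (Fin k → Fin (n G)) λ f →
    Injective _≡_ _≡_ f × (∀ i j → Consecutive k i j → Adj G (f i) (f j))

NoCyclesUpTo : Graph → ℕ → Set
NoCyclesUpTo G g = ∀ k → k ≤ g → ¬ HasCycleOfLength G k

InducedIsCycle : (G : Graph) → Subset (n G) → ℕ → Set
InducedIsCycle G A k =
  (3 ≤ k) × Σ (Fin k → Fin (n G)) λ f →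
    Injective _≡_ _≡_ f
    × (∀ x → (x ∈ A) ⇔ (∃ λ i → f i ≡ x))
    × (∀ i j → Adj G (f i) (f j) ⇔ (Consecutive k i j ⊎ Consecutive k j i))

data WalkIn (G : Graph) (S : Subset (n G)) : Fin (n G) → Fin (n G) → Set where
  here : ∀ {u} → u ∈ S → WalkIn G S u u
  step : ∀ {u w v} → u ∈ S → Adj G u w → WalkIn G S w v → WalkIn G S u v

InducedConnected : (G : Graph) → Subset (n G) → Set
InducedConnected G S = ∀ u v → u ∈ S → v ∈ S → WalkIn G S u v

-- Forward: deleting one vertex from a cycle leaves a path, which is connected.
--
-- Backward: if every G[A - a] is connected then every vertex of G[A] has two
-- neighbours in A (reach a third vertex of A while avoiding the other one).
-- Grow a path in G[A] from one end: its first vertex has a neighbour w in A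
-- other than the second vertex.  If w is new the path grows; otherwise w sits
-- at some position J ≥ 2 and closes a cycle of length J + 1, so the girth
-- forces J ≥ g.  As a path has at most |A| = g + 1 vertices, this happens
-- exactly when the path has visited all of A, closing a Hamiltonian cycle of
-- G[A].  A chord of that cycle would again close a cycle of length at most g,
-- so G[A] is exactly this cycle.

module Submission where

open import Defs
open import Data.Nat using (ℕ; zero; suc; _+_; _∸_; _≤_; _<_; z≤n; s≤s)
open import Data.Nat.Properties
open import Data.Fin using (Fin; zero; suc; toℕ; fromℕ; fromℕ<)
open import Data.Fin.Properties
  using (toℕ-injective; toℕ-fromℕ; toℕ-fromℕ<; toℕ<n; toℕ≤pred[n]; any?)
  renaming (_≟_ to _≟ᶠ_; 0≢1+n to 0≢1+nᶠ; suc-injective to suc-injectiveᶠ)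
open import Data.Fin.Subset using (Subset; _∈_; _∉_; _-_; ∣_∣; Nonempty; inside; outside)
open import Data.Fin.Subset.Properties
  using (p─⊥≡p; p─q⊆p; x∈p∧x≢y⇒x∈p-y; x∈p⇒∣p-x∣<∣p∣; nonempty?; Empty-unique; ∣⊥∣≡0)

open import Data.Vec using (_∷_; there)
open import Data.Product using (∃; _×_; _,_)
open import Data.Sum using (_⊎_; inj₁; inj₂; [_,_]; swap)
open import Data.Empty using (⊥-elim)
open import Function using (_∘_)
open import Relation.Nullary using (yes; no; contradiction)
open import Relation.Binary.Definitions using (tri<; tri≈; tri>)
open import Relation.Binary.PropositionalEquality using (_≡_; _≢_; refl; trans; cong; subst)
  renaming (sym to ≡-sym)
open import Function.Definitions using (Injective)
open import Function.Bundles using (_⇔_; mk⇔; Equivalence)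

open Equivalence using (to; from)

private
  variable
    N k m : ℕ

-- Cardinalities of finite subsets

x∉p-x : (p : Subset N) (x : Fin N) → x ∉ p - x
x∉p-x (_ ∷ p) zero    ()
x∉p-x (_ ∷ p) (suc x) (there x∈p-x) = x∉p-x p x x∈p-x

x∈p-y⇒x∈p : ∀ {p : Subset N} {x y} → x ∈ p - y → x ∈ p
x∈p-y⇒x∈p {p = p} = p─q⊆p p _

x∈p-y⇒x≢y : ∀ {p : Subset N} {x y} → x ∈ p - y → x ≢ y
x∈p-y⇒x≢y {p = p} x∈p-y refl = x∉p-x p _ x∈p-y

∣p∣≤1+∣p-x∣ : (p : Subset N) (x : Fin N) → ∣ p ∣ ≤ suc ∣ p - x ∣
∣p∣≤1+∣p-x∣ (inside  ∷ p) zero    = s≤s (≤-reflexive (cong ∣_∣ (≡-sym (p─⊥≡p p))))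
∣p∣≤1+∣p-x∣ (outside ∷ p) zero    = m≤n⇒m≤1+n (≤-reflexive (cong ∣_∣ (≡-sym (p─⊥≡p p))))
∣p∣≤1+∣p-x∣ (inside  ∷ p) (suc x) = s≤s (∣p∣≤1+∣p-x∣ p x)
∣p∣≤1+∣p-x∣ (outside ∷ p) (suc x) = ∣p∣≤1+∣p-x∣ p x

1+k≤∣p∣⇒k≤∣p-x∣ : (p : Subset N) (x : Fin N) → suc k ≤ ∣ p ∣ → k ≤ ∣ p - x ∣
1+k≤∣p∣⇒k≤∣p-x∣ p x 1+k≤∣p∣ = ≤-pred (≤-trans 1+k≤∣p∣ (∣p∣≤1+∣p-x∣ p x))

∣p∣>0⇒Nonempty : (p : Subset N) → 0 < ∣ p ∣ → Nonempty p
∣p∣>0⇒Nonempty {N} p 0<∣p∣ with nonempty? p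
... | yes p≠∅ = p≠∅
... | no  p=∅ = contradiction (trans (cong ∣_∣ (Empty-unique p=∅)) (∣⊥∣≡0 N)) (>⇒≢ 0<∣p∣)

injective⇒≤∣p∣ : ∀ {p : Subset N} {f : Fin k → Fin N} →
                 Injective _≡_ _≡_ f → (∀ i → f i ∈ p) → k ≤ ∣ p ∣
injective⇒≤∣p∣ {k = zero}  _     _   = z≤n
injective⇒≤∣p∣ {k = suc k} {p = p} {f} f-inj f∈p =
  ≤-trans (s≤s (injective⇒≤∣p∣ (suc-injectiveᶠ ∘ f-inj) f∘suc∈p-f₀))
          (x∈p⇒∣p-x∣<∣p∣ (f∈p zero))
  where
  f∘suc∈p-f₀ : ∀ i → f (suc i) ∈ p - f zero
  f∘suc∈p-f₀ i = x∈p∧x≢y⇒x∈p-y (f∈p (suc i)) (0≢1+nᶠ ∘ ≡-sym ∘ f-inj)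

injective⇒onto : ∀ {p : Subset N} {f : Fin k → Fin N} →
                 Injective _≡_ _≡_ f → (∀ i → f i ∈ p) → ∣ p ∣ ≤ k →
                 ∀ {x} → x ∈ p → ∃ λ i → f i ≡ x
injective⇒onto {N} {k} {p} {f} f-inj f∈p ∣p∣≤k {x} x∈p with any? (λ i → f i ≟ᶠ x)
... | yes hit  = hit
... | no  miss = contradiction ∣p∣≤k (<⇒≱ (injective⇒≤∣p∣ x∷f-inj x∷f∈p))
  where
  x∷f : Fin (suc k) → Fin N
  x∷f zero    = x
  x∷f (suc i) = f i

  x∷f-inj : Injective _≡_ _≡_ x∷f
  x∷f-inj {zero}  {zero}  _ = refl
  x∷f-inj {zero}  {suc j} e = contradiction (j , ≡-sym e) miss
  x∷f-inj {suc i} {zero}  e = contradiction (i , e) miss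
  x∷f-inj {suc i} {suc j} e = cong suc (f-inj e)

  x∷f∈p : ∀ i → x∷f i ∈ p
  x∷f∈p zero    = x∈p
  x∷f∈p (suc i) = f∈p i

-- Walks

module _ {G : Graph} {S : Subset (n G)} where

  source∈ : ∀ {u v} → WalkIn G S u v → u ∈ S
  source∈ (here u∈S)     = u∈S
  source∈ (step u∈S _ _) = u∈S

  _++ʷ_ : ∀ {u v w} → WalkIn G S u v → WalkIn G S v w → WalkIn G S u w
  here _       ++ʷ q = q
  step u∈S e p ++ʷ q = step u∈S e (p ++ʷ q)

  reverseʷ : ∀ {u v} → WalkIn G S u v → WalkIn G S v u
  reverseʷ (here v∈S)     = here v∈S
  reverseʷ (step u∈S e p) = reverseʷ p ++ʷ step (source∈ p) (sym G e) (here u∈S)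

  first-step : ∀ {u v} → WalkIn G S u v → u ≢ v → ∃ λ w → w ∈ S × Adj G u w
  first-step (here _)     u≢u = contradiction refl u≢u
  first-step (step _ e p) _   = _ , source∈ p , e

module _ {G : Graph} {S : Subset (n G)} (f : Fin k → Fin (n G))
         (f-step : ∀ i j → toℕ j ≡ suc (toℕ i) → Adj G (f i) (f j)) where

  segment-walk : ∀ {x y} → toℕ x ≤ toℕ y →
                 (∀ z → toℕ x ≤ toℕ z → toℕ z ≤ toℕ y → f z ∈ S) →
                 WalkIn G S (f x) (f y)
  segment-walk {x} {y} x≤y = go (toℕ y ∸ toℕ x) (m∸n+n≡m x≤y)
    where
    go : ∀ d {x} → d + toℕ x ≡ toℕ y →
         (∀ z → toℕ x ≤ toℕ z → toℕ z ≤ toℕ y → f z ∈ S) → WalkIn G S (f x) (f y)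
    go zero    {x} x≡y f∈S = subst (WalkIn G S (f x) ∘ f) (toℕ-injective x≡y)
                                   (here (f∈S x ≤-refl (≤-reflexive x≡y)))
    go (suc d) {x} e   f∈S =
      step (f∈S x ≤-refl (subst (toℕ x ≤_) e (m≤n+m (toℕ x) (suc d))))
           (f-step x x′ x′≡1+x)
           (go d (trans (cong (d +_) x′≡1+x) (trans (+-suc d (toℕ x)) e))
               (λ z x′≤z → f∈S z (≤-trans (n≤1+n _) (subst (_≤ toℕ z) x′≡1+x x′≤z))))
      where
      1+x<k : suc (toℕ x) < k
      1+x<k = ≤-<-trans (s≤s (m≤n+m (toℕ x) d)) (subst (_< k) (≡-sym e) (toℕ<n y))

      x′ : Fin k
      x′ = fromℕ< 1+x<k

      x′≡1+x : toℕ x′ ≡ suc (toℕ x)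
      x′≡1+x = toℕ-fromℕ< 1+x<k

module CycleMinusVertex {G : Graph} {S : Subset (n G)} (f : Fin (suc k) → Fin (n G))
  (f-step : ∀ i j → toℕ j ≡ suc (toℕ i) → Adj G (f i) (f j))
  (f-wrap : Adj G (f zero) (f (fromℕ k)))
  (i₀ : Fin (suc k)) (f∈S : ∀ z → z ≢ i₀ → f z ∈ S) where

  avoiding-walk : ∀ {x y} → toℕ x ≤ toℕ y → toℕ i₀ < toℕ x ⊎ toℕ y < toℕ i₀ →
                  WalkIn G S (f x) (f y)
  avoiding-walk x≤y i₀∉[x,y] = segment-walk f f-step x≤y λ z x≤z z≤y → f∈S z λ where
    refl → [ (λ i₀<x → <⇒≱ i₀<x x≤z) , (λ y<i₀ → <⇒≱ y<i₀ z≤y) ] i₀∉[x,y]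

  ordered-walk : ∀ {i j} → i ≢ i₀ → j ≢ i₀ → toℕ i ≤ toℕ j → WalkIn G S (f i) (f j)
  ordered-walk {i} {j} i≢i₀ j≢i₀ i≤j with <-cmp (toℕ i₀) (toℕ i) | <-cmp (toℕ j) (toℕ i₀)
  ... | tri< i₀<i _ _ | _              = avoiding-walk i≤j (inj₁ i₀<i)
  ... | _             | tri< j<i₀ _ _  = avoiding-walk i≤j (inj₂ j<i₀)
  ... | tri≈ _ i₀≡i _ | _              = contradiction (toℕ-injective (≡-sym i₀≡i)) i≢i₀
  ... | _             | tri≈ _ j≡i₀ _  = contradiction (toℕ-injective j≡i₀) j≢i₀
  ... | tri> _ _ i<i₀ | tri> _ _ i₀<j  =
    reverseʷ (avoiding-walk z≤n (inj₂ i<i₀)) ++ʷ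
    step (f∈S zero λ { refl → n≮0 i<i₀ }) f-wrap (reverseʷ (avoiding-walk j≤k (inj₁ i₀<j)))
    where
    j≤k : toℕ j ≤ toℕ (fromℕ k)
    j≤k = subst (toℕ j ≤_) (≡-sym (toℕ-fromℕ k)) (toℕ≤pred[n] j)

  walk : ∀ {i j} → i ≢ i₀ → j ≢ i₀ → WalkIn G S (f i) (f j)
  walk {i} {j} i≢i₀ j≢i₀ with ≤-total (toℕ i) (toℕ j)
  ... | inj₁ i≤j = ordered-walk i≢i₀ j≢i₀ i≤j
  ... | inj₂ j≤i = reverseʷ (ordered-walk j≢i₀ i≢i₀ j≤i)

induced-cycle⇒deletions-connected : ∀ {G : Graph} {A : Subset (n G)} →
  InducedIsCycle G A (suc k) → ∀ a → a ∈ A → InducedConnected G (A - a)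
induced-cycle⇒deletions-connected {k} {G} {A} (_ , f , f-inj , f-onto , f-adj) a a∈A u v u∈ v∈
  with to (f-onto a) a∈A | to (f-onto u) (x∈p-y⇒x∈p u∈) | to (f-onto v) (x∈p-y⇒x∈p v∈)
... | i₀ , refl | i , refl | j , refl =
  CycleMinusVertex.walk f f-step f-wrap i₀ f∈A-f₀ (off-i₀ u∈) (off-i₀ v∈)
  where
  f-step : ∀ i j → toℕ j ≡ suc (toℕ i) → Adj G (f i) (f j)
  f-step i j j≡1+i = from (f-adj i j) (inj₁ (inj₁ j≡1+i))

  f-wrap : Adj G (f zero) (f (fromℕ k))
  f-wrap = from (f-adj zero (fromℕ k)) (inj₂ (inj₂ (cong suc (toℕ-fromℕ k) , refl)))

  f∈A-f₀ : ∀ z → z ≢ i₀ → f z ∈ A - f i₀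
  f∈A-f₀ z z≢i₀ = x∈p∧x≢y⇒x∈p-y (from (f-onto (f z)) (z , refl)) (z≢i₀ ∘ f-inj)

  off-i₀ : ∀ {z} → f z ∈ A - f i₀ → z ≢ i₀
  off-i₀ fz∈ z≡i₀ = x∈p-y⇒x≢y fz∈ (cong f z≡i₀)

-- Paths in induced subgraphs

MinDegree≥2 : (G : Graph) → Subset (n G) → Set
MinDegree≥2 G A = ∀ {u y} → u ∈ A → y ∈ A → u ≢ y → ∃ λ w → w ∈ A × w ≢ y × Adj G u w

deletions-connected⇒MinDegree≥2 : ∀ {G : Graph} {A : Subset (n G)} → 3 ≤ ∣ A ∣ →
  (∀ a → a ∈ A → InducedConnected G (A - a)) → MinDegree≥2 G A
deletions-connected⇒MinDegree≥2 {G} {A} 3≤∣A∣ connected {u} {y} u∈A y∈A u≢y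
  with ∣p∣>0⇒Nonempty (A - y - u) (1+k≤∣p∣⇒k≤∣p-x∣ (A - y) u (1+k≤∣p∣⇒k≤∣p-x∣ A y 3≤∣A∣))
... | v , v∈A-y-u
  with first-step (connected y y∈A u v (x∈p∧x≢y⇒x∈p-y u∈A u≢y) (x∈p-y⇒x∈p v∈A-y-u))
                  (x∈p-y⇒x≢y v∈A-y-u ∘ ≡-sym)
... | w , w∈A-y , u~w = w , x∈p-y⇒x∈p w∈A-y , x∈p-y⇒x≢y w∈A-y , u~w

-- A path with m edges in G[A]; vertex i is junk for i > m.
record PathIn (G : Graph) (A : Subset (n G)) (m : ℕ) : Set where
  field
    vertex    : ℕ → Fin (n G)
    vertex∈A  : ∀ {i} → i ≤ m → vertex i ∈ A
    injective : ∀ {i j} → i ≤ m → j ≤ m → vertex i ≡ vertex j → i ≡ j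
    adjacent  : ∀ {i} → i < m → Adj G (vertex i) (vertex (suc i))

  vertices : Fin (suc m) → Fin (n G)
  vertices i = vertex (toℕ i)

  vertices-injective : Injective _≡_ _≡_ vertices
  vertices-injective {i} {j} = toℕ-injective ∘ injective (toℕ≤pred[n] i) (toℕ≤pred[n] j)

  vertices∈A : ∀ i → vertices i ∈ A
  vertices∈A i = vertex∈A (toℕ≤pred[n] i)

open PathIn

ClosedPathIn : (G : Graph) → Subset (n G) → ℕ → Set
ClosedPathIn G A m = ∃ λ (p : PathIn G A m) → Adj G (vertex p m) (vertex p 0)

module _ {G : Graph} {A : Subset (n G)} where

  single : ∀ {u} → u ∈ A → PathIn G A 0
  single {u} u∈A = record
    { vertex    = λ _ → u
    ; vertex∈A  = λ _ → u∈A
    ; injective = λ { z≤n z≤n _ → refl }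
    ; adjacent  = λ ()
    }

  prepend : (p : PathIn G A m) → ∀ {w} → w ∈ A → Adj G w (vertex p 0) →
            (∀ {j} → j ≤ m → vertex p j ≢ w) → PathIn G A (suc m)
  prepend {m} p {w} w∈A w~p₀ w∉p = record
    { vertex    = w∷p
    ; vertex∈A  = w∷p∈A
    ; injective = w∷p-injective
    ; adjacent  = w∷p-adjacent
    }
    where
    w∷p : ℕ → Fin (n G)
    w∷p zero    = w
    w∷p (suc i) = vertex p i

    w∷p∈A : ∀ {i} → i ≤ suc m → w∷p i ∈ A
    w∷p∈A {zero}  _         = w∈A
    w∷p∈A {suc i} (s≤s i≤m) = vertex∈A p i≤m

    w∷p-injective : ∀ {i j} → i ≤ suc m → j ≤ suc m → w∷p i ≡ w∷p j → i ≡ j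
    w∷p-injective {zero}  {zero}  _         _         _ = refl
    w∷p-injective {zero}  {suc j} _         (s≤s j≤m) e = contradiction (≡-sym e) (w∉p j≤m)
    w∷p-injective {suc i} {zero}  (s≤s i≤m) _         e = contradiction e (w∉p i≤m)
    w∷p-injective {suc i} {suc j} (s≤s i≤m) (s≤s j≤m) e = cong suc (injective p i≤m j≤m e)

    w∷p-adjacent : ∀ {i} → i < suc m → Adj G (w∷p i) (w∷p (suc i))
    w∷p-adjacent {zero}  _         = w~p₀
    w∷p-adjacent {suc i} (s≤s i<m) = adjacent p i<m

  length<∣A∣ : PathIn G A m → suc m ≤ ∣ A ∣
  length<∣A∣ p = injective⇒≤∣p∣ (vertices-injective p) (vertices∈A p)

  window-cycle : (p : PathIn G A m) → ∀ {i d} → 2 ≤ d → i + d ≤ m →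
                 Adj G (vertex p (i + d)) (vertex p i) → HasCycleOfLength G (suc d)
  window-cycle {m} p {i} {d} 2≤d i+d≤m closing = s≤s 2≤d , c , c-injective , c-adjacent
    where
    c : Fin (suc d) → Fin (n G)
    c t = vertex p (i + toℕ t)

    within : ∀ {t} → t ≤ d → i + t ≤ m
    within t≤d = ≤-trans (+-monoʳ-≤ i t≤d) i+d≤m

    c-injective : Injective _≡_ _≡_ c
    c-injective {t} {t′} e = toℕ-injective (+-cancelˡ-≡ i _ _
      (injective p (within (toℕ≤pred[n] t)) (within (toℕ≤pred[n] t′)) e))

    c-adjacent : ∀ t t′ → Consecutive (suc d) t t′ → Adj G (c t) (c t′)
    c-adjacent t t′ (inj₁ t′≡1+t) rewrite t′≡1+t | +-suc i (toℕ t) =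
      adjacent p (subst (_≤ m) (+-suc i (toℕ t))
                        (within (subst (_≤ d) t′≡1+t (toℕ≤pred[n] t′))))
    c-adjacent t t′ (inj₂ (1+t≡1+d , t′≡0))
      rewrite suc-injective 1+t≡1+d | t′≡0 | +-identityʳ i = closing

module _ {G : Graph} {A : Subset (n G)} {g : ℕ} (girth : NoCyclesUpTo G g) where

  chord⇒long : (p : PathIn G A m) → ∀ {i j} → suc i < j → j ≤ m →
               Adj G (vertex p i) (vertex p j) → i + g ≤ j
  chord⇒long {m} p {i} {j} 1+i<j j≤m vᵢ~vⱼ = subst (i + g ≤_) i+d≡j (+-monoʳ-≤ i g≤d)
    where
    d : ℕ
    d = j ∸ i

    i+d≡j : i + d ≡ j
    i+d≡j = m+[n∸m]≡n (<⇒≤ (<-trans (n<1+n i) 1+i<j))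

    cycle : HasCycleOfLength G (suc d)
    cycle = window-cycle p (subst (_≤ d) (m+n∸n≡m 2 i) (∸-monoˡ-≤ i 1+i<j))
                         (subst (_≤ m) (≡-sym i+d≡j) j≤m)
                         (subst (λ t → Adj G (vertex p t) (vertex p i)) (≡-sym i+d≡j) (sym G vᵢ~vⱼ))

    g≤d : g ≤ d
    g≤d = ≮⇒≥ λ d<g → girth (suc d) d<g cycle

  module _ (∣A∣≡1+g : ∣ A ∣ ≡ suc g) where

    length≤g : PathIn G A m → m ≤ g
    length≤g p = ≤-pred (subst (_ ≤_) ∣A∣≡1+g (length<∣A∣ p))

    extend-or-close : MinDegree≥2 G A → (p : PathIn G A m) → 1 ≤ m →
                      ClosedPathIn G A g ⊎ PathIn G A (suc m)
    extend-or-close {m} δ p 1≤m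
      with δ (vertex∈A p z≤n) (vertex∈A p 1≤m) (0≢1+n ∘ injective p z≤n 1≤m)
    ... | w , w∈A , w≢v₁ , v₀~w with anyUpTo? (λ j → vertex p j ≟ᶠ w) (suc m)
    ...   | no  w∉p = inj₂ (prepend p w∈A (sym G v₀~w) λ j≤m vⱼ≡w → w∉p (_ , s≤s j≤m , vⱼ≡w))
    ...   | yes (zero , _ , v₀≡w) =
            ⊥-elim (irrefl G (subst (Adj G (vertex p 0)) (≡-sym v₀≡w) v₀~w))
    ...   | yes (suc zero , _ , v₁≡w) = contradiction (≡-sym v₁≡w) w≢v₁
    -- The edge v₀ ~ v_J closes a cycle of length J + 1, so g ≤ J ≤ m ≤ g.
    ...   | yes (J@(suc (suc _)) , s≤s J≤m , vJ≡w) =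
            inj₁ (subst (ClosedPathIn G A) m≡g (p , closing))
      where
      v₀~vJ : Adj G (vertex p 0) (vertex p J)
      v₀~vJ = subst (Adj G (vertex p 0)) (≡-sym vJ≡w) v₀~w

      g≤J : g ≤ J
      g≤J = chord⇒long p (s≤s (s≤s z≤n)) J≤m v₀~vJ

      m≡g : m ≡ g
      m≡g = ≤-antisym (length≤g p) (≤-trans g≤J J≤m)

      closing : Adj G (vertex p m) (vertex p 0)
      closing = subst (λ t → Adj G (vertex p t) (vertex p 0))
                      (≤-antisym J≤m (≤-trans (length≤g p) g≤J)) (sym G v₀~vJ)

    hamiltonian : MinDegree≥2 G A → 1 ≤ g → ClosedPathIn G A g
    hamiltonian δ 1≤g with ∣p∣>0⇒Nonempty A (subst (0 <_) (≡-sym ∣A∣≡1+g) (s≤s z≤n))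
    ... | u , u∈A
      with ∣p∣>0⇒Nonempty (A - u) (1+k≤∣p∣⇒k≤∣p-x∣ A u (subst (2 ≤_) (≡-sym ∣A∣≡1+g) (s≤s 1≤g)))
    ... | y , y∈A-u with δ u∈A (x∈p-y⇒x∈p y∈A-u) (x∈p-y⇒x≢y y∈A-u ∘ ≡-sym)
    ... | w , w∈A , _ , u~w = grow (g ∸ 1) (m∸n+n≡m 1≤g) ≤-refl edge
      where
      edge : PathIn G A 1
      edge = prepend (single u∈A) w∈A (sym G u~w)
               λ { z≤n u≡w → irrefl G (subst (Adj G u) (≡-sym u≡w) u~w) }

      grow : ∀ r {m} → r + m ≡ g → 1 ≤ m → PathIn G A m → ClosedPathIn G A g
      grow r e 1≤m p with extend-or-close δ p 1≤m
      ... | inj₁ closed = closed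
      grow zero    m≡g _ p | inj₂ p′ = contradiction (subst (_ ≤_) (≡-sym m≡g) (length≤g p′)) 1+n≰n
      grow (suc r) e   _ p | inj₂ p′ = grow r (trans (+-suc r _) e) (s≤s z≤n) p′

    closed-path⇒induced-cycle : 3 ≤ suc g → ClosedPathIn G A g → InducedIsCycle G A (suc g)
    closed-path⇒induced-cycle 3≤1+g (p , closing) = 3≤1+g , f , f-injective , f-onto , f-adjacent
      where
      f : Fin (suc g) → Fin (n G)
      f = vertices p

      f-injective : Injective _≡_ _≡_ f
      f-injective = vertices-injective p

      f-onto : ∀ x → (x ∈ A) ⇔ ∃ λ i → f i ≡ x
      f-onto x = mk⇔ (injective⇒onto f-injective (vertices∈A p) (≤-reflexive ∣A∣≡1+g))
                     λ { (i , refl) → vertices∈A p i }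

      consecutive⇒adjacent : ∀ i j → Consecutive (suc g) i j → Adj G (f i) (f j)
      consecutive⇒adjacent i j (inj₁ j≡1+i) rewrite j≡1+i =
        adjacent p (subst (_≤ g) j≡1+i (toℕ≤pred[n] j))
      consecutive⇒adjacent i j (inj₂ (1+i≡1+g , j≡0))
        rewrite suc-injective 1+i≡1+g | j≡0 = closing

      adjacent⇒consecutive : ∀ i j → toℕ i < toℕ j → Adj G (f i) (f j) →
                             Consecutive (suc g) i j ⊎ Consecutive (suc g) j i
      adjacent⇒consecutive i j i<j fᵢ~fⱼ with toℕ j ≟ suc (toℕ i)
      ... | yes j≡1+i = inj₁ (inj₁ j≡1+i)
      ... | no  j≢1+i = inj₂ (inj₂ (cong suc j≡g , i≡0))
        where
        j≤g : toℕ j ≤ g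
        j≤g = toℕ≤pred[n] j

        i+g≤j : toℕ i + g ≤ toℕ j
        i+g≤j = chord⇒long p (≤∧≢⇒< i<j (j≢1+i ∘ ≡-sym)) j≤g fᵢ~fⱼ

        i≡0 : toℕ i ≡ 0
        i≡0 = n≤0⇒n≡0 (+-cancelʳ-≤ g (toℕ i) 0 (≤-trans i+g≤j j≤g))

        j≡g : toℕ j ≡ g
        j≡g = ≤-antisym j≤g (≤-trans (m≤n+m g (toℕ i)) i+g≤j)

      f-adjacent : ∀ i j → Adj G (f i) (f j) ⇔ (Consecutive (suc g) i j ⊎ Consecutive (suc g) j i)
      f-adjacent i j = mk⇔ to′ [ consecutive⇒adjacent i j , sym G ∘ consecutive⇒adjacent j i ]
        where
        to′ : Adj G (f i) (f j) → Consecutive (suc g) i j ⊎ Consecutive (suc g) j i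
        to′ fᵢ~fⱼ with <-cmp (toℕ i) (toℕ j)
        ... | tri< i<j _ _ = adjacent⇒consecutive i j i<j fᵢ~fⱼ
        ... | tri≈ _ i≡j _ =
          ⊥-elim (irrefl G (subst (Adj G (f i) ∘ f) (≡-sym (toℕ-injective i≡j)) fᵢ~fⱼ))
        ... | tri> _ _ j<i = swap (adjacent⇒consecutive j i j<i (sym G fᵢ~fⱼ))

lemma10 : (g : ℕ) → 3 ≤ g → (G : Graph) → NoCyclesUpTo G g →
    (A : Subset (n G)) → ∣ A ∣ ≡ suc g →
    InducedIsCycle G A (suc g) ⇔ (∀ a → a ∈ A → InducedConnected G (A - a))
lemma10 g 3≤g G girth A ∣A∣≡1+g = mk⇔ induced-cycle⇒deletions-connected λ connected →
  closed-path⇒induced-cycle {G} {A} {g} girth ∣A∣≡1+g 3≤1+g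
    (hamiltonian {G} {A} {g} girth ∣A∣≡1+g
      (deletions-connected⇒MinDegree≥2 (subst (3 ≤_) (≡-sym ∣A∣≡1+g) 3≤1+g) connected)
      (≤-trans (s≤s z≤n) 3≤g))
  where
  3≤1+g : 3 ≤ suc g
  3≤1+g = m≤n⇒m≤1+n 3≤g
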